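{- For every integer $n\ge1$, \[ \sum_{k=1}^{n}\tau(k)\,\omega(n-k)=\sum_{\substack{m+k=n\\ m\ge 1,\ k\ge 0}}\sum_{j\ge0}\omega(k-jm), \] where $\tau(k)$ is the number of positive divisors of $k$.
   Context: For integers $m$, $\omega(m)=1$ if $m=0$; $\omega(m)=(-1)^i$ if $m=\frac{3i^2\pm i}{2}$ for some positive integer $i$; $\omega(m)=0$ otherwise (in particular for $m<0$). -}

module Defs where

open import Data.Nat as ℕ using (ℕ; zero; suc; _*_; _∸_)
open import Data.Nat.Divisibility using (_∣?_)
open import Data.Integer as ℤ using (ℤ; +_; -[1+_])
open import Data.List using (List; []; _∷_; map; foldr; sum; filter; length; upTo)
open import Relation.Nullary.Decidable using (⌊_⌋)
open import Data.Bool using (Bool; true; false; if_then_else_; _∨_)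

-- Σ_{i=a}^{b} f i  (integer-valued, over natural i), empty if b < a
∑ℤ[_⋯_] : ℕ → ℕ → (ℕ → ℤ) → ℤ
∑ℤ[ a ⋯ b ] f = foldr ℤ._+_ (+ 0) (map (λ t → f (a ℕ.+ t)) (upTo (suc b ∸ a)))

τ : ℕ → ℕ
τ k = length (filter (λ d → d ∣? k) (map suc (upTo k)))

pentMinus pentPlus : ℕ → ℕ
pentMinus i = ℕ._/_ (3 * i * i ∸ i) 2
pentPlus  i = ℕ._/_ (3 * i * i ℕ.+ i) 2

sgn : ℕ → ℤ
sgn i = if ⌊ ℕ._%_ i 2 ℕ.≟ 0 ⌋ then + 1 else ℤ.-_ (+ 1)

-- search i = 1 … fuel for m = (3i² ± i)/2; returns (-1)^i on a hit, else 0.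
-- For m ≥ 1 any such i satisfies i ≤ m, so fuel = m makes the search exhaustive;
-- the generalised pentagonal numbers for i ≥ 1 are pairwise distinct, so the
-- result is well defined.
ωsearch : ℕ → ℕ → ℤ
ωsearch m zero = + 0
ωsearch m (suc f) =
  if ⌊ m ℕ.≟ pentMinus (suc f) ⌋ ∨ ⌊ m ℕ.≟ pentPlus (suc f) ⌋
  then sgn (suc f) else ωsearch m f

ωℕ : ℕ → ℤ
ωℕ zero = + 1
ωℕ (suc m) = ωsearch (suc m) (suc m)

ω : ℤ → ℤ
ω (+ m) = ωℕ m
ω -[1+ m ] = + 0

-- Both sides sum ω(n - d) over the pairs (m, q) of positive integers with d = m q ≤ n:
-- the left side groups the pairs by d, of which there are τ(d), the right side by m,
-- with j = q - 1.
module Submission where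

open import Defs
open import Data.Nat using (ℕ; suc; _≥_; _∸_)
open import Data.Integer using (ℤ; +_; _-_; _*_)
open import Relation.Binary.PropositionalEquality using (_≡_)

open import Data.Integer using (-[1+_]; _+_; -_; _⊖_)
open import Data.Integer.Properties as ℤP
  using (*-identityˡ; *-distribʳ-+; +-identityˡ; +-identityʳ; m-n≡m⊖n; ⊖-≥; ⊖-<;
         pos-*)
open import Algebra.Properties.CommutativeSemigroup ℤP.+-commutativeSemigroup
  using (interchange)
open import Data.List using (foldr; filter; length; applyUpTo)
open import Data.List.Properties using (map-upTo)
open import Data.Nat as ℕ
  using (zero; _<_; _≤_; _≤?_; _≟_; z≤n; s≤s; z<s; s<s; s≤s⁻¹)
open import Data.Nat.Divisibility using (_∣?_; divides; ∣⇒≤)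
open import Data.Nat.Properties as ℕP using (suc-injective; ≤-trans; ≤-reflexive)
open import Function using (_∘_)
open import Relation.Binary.PropositionalEquality
  using (_≢_; refl; sym; trans; cong; cong₂; module ≡-Reasoning)
open import Relation.Nullary using (Dec; yes; no; ¬_; contradiction)
open import Relation.Unary using (Decidable)

∑ : ℕ → (ℕ → ℤ) → ℤ
∑ zero    f = + 0
∑ (suc N) f = f 0 + ∑ N (f ∘ suc)

syntax ∑ N (λ i → e) = ∑[ i < N ] e

∑-cong : ∀ N {f g : ℕ → ℤ} → (∀ {i} → i < N → f i ≡ g i) → ∑ N f ≡ ∑ N g
∑-cong zero    eq = refl
∑-cong (suc N) eq = cong₂ _+_ (eq z<s) (∑-cong N (eq ∘ s<s))

∑-zero : ∀ N {f : ℕ → ℤ} → (∀ {i} → i < N → f i ≡ + 0) → ∑ N f ≡ + 0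
∑-zero zero    _      = refl
∑-zero (suc N) vanish = cong₂ _+_ (vanish z<s) (∑-zero N (vanish ∘ s<s))

∑-single : ∀ {N} {f : ℕ → ℤ} x → x < N →
           (∀ {i} → i < N → i ≢ x → f i ≡ + 0) → ∑ N f ≡ f x
∑-single {suc N} {f} zero _ vanish = begin
  f 0 + ∑ N (f ∘ suc)
    ≡⟨ cong (λ x → f 0 + x) (∑-zero N (λ i<N → vanish (s<s i<N) (λ ()))) ⟩
  f 0 + + 0
    ≡⟨ +-identityʳ (f 0) ⟩
  f 0
    ∎
  where open ≡-Reasoning
∑-single {suc N} {f} (suc x) (s<s x<N) vanish = begin
  f 0 + ∑ N (f ∘ suc)
    ≡⟨ cong (_+ ∑ N (f ∘ suc)) (vanish z<s (λ ())) ⟩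
  + 0 + ∑ N (f ∘ suc)
    ≡⟨ +-identityˡ _ ⟩
  ∑ N (f ∘ suc)
    ≡⟨ ∑-single x x<N (λ i<N i≢x → vanish (s<s i<N) (i≢x ∘ suc-injective)) ⟩
  f (suc x)
    ∎
  where open ≡-Reasoning

∑-extend : ∀ {a N} {f : ℕ → ℤ} → a ≤ N →
           (∀ {i} → a ≤ i → i < N → f i ≡ + 0) → ∑ a f ≡ ∑ N f
∑-extend {zero}  {N}     _    vanish = sym (∑-zero N (vanish z≤n))
∑-extend {suc a} {suc N} {f} a≤N vanish =
  cong (λ x → f 0 + x) (∑-extend (s≤s⁻¹ a≤N) (λ a≤i i<N → vanish (s≤s a≤i) (s<s i<N)))

∑-distrib-+ : ∀ N (f g : ℕ → ℤ) → ∑[ i < N ] (f i + g i) ≡ ∑ N f + ∑ N g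
∑-distrib-+ zero    f g = refl
∑-distrib-+ (suc N) f g =
  trans (cong (λ x → f 0 + g 0 + x) (∑-distrib-+ N (f ∘ suc) (g ∘ suc)))
        (interchange (f 0) (g 0) _ _)

*-distribʳ-∑ : ∀ N (f : ℕ → ℤ) c → ∑ N f * c ≡ ∑[ i < N ] (f i * c)
*-distribʳ-∑ zero    f c = refl
*-distribʳ-∑ (suc N) f c =
  trans (*-distribʳ-+ c (f 0) _) (cong (λ x → f 0 * c + x) (*-distribʳ-∑ N (f ∘ suc) c))

∑-comm : ∀ M N (F : ℕ → ℕ → ℤ) → ∑[ i < M ] ∑[ j < N ] F i j ≡ ∑[ j < N ] ∑[ i < M ] F i j
∑-comm zero    N F = sym (∑-zero N (λ _ → refl))
∑-comm (suc M) N F =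
  trans (cong (λ x → ∑ N (F 0) + x) (∑-comm M N (F ∘ suc))) (sym (∑-distrib-+ N (F 0) _))

foldr-+-applyUpTo : ∀ N (f : ℕ → ℤ) → foldr _+_ (+ 0) (applyUpTo f N) ≡ ∑ N f
foldr-+-applyUpTo zero    f = refl
foldr-+-applyUpTo (suc N) f = cong (λ x → f 0 + x) (foldr-+-applyUpTo N (f ∘ suc))

∑ℤ-as-∑ : ∀ a b (f : ℕ → ℤ) → ∑ℤ[ a ⋯ b ] f ≡ ∑[ i < suc b ∸ a ] f (a ℕ.+ i)
∑ℤ-as-∑ a b f = trans (cong (foldr _+_ (+ 0)) (map-upTo _ (suc b ∸ a)))
                      (foldr-+-applyUpTo (suc b ∸ a) (λ i → f (a ℕ.+ i)))

𝟙 : ∀ {p} {P : Set p} → Dec P → ℤ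
𝟙 (yes _) = + 1
𝟙 (no _)  = + 0

𝟙-yes : ∀ {p} {P : Set p} (P? : Dec P) → P → 𝟙 P? ≡ + 1
𝟙-yes (yes _) _ = refl
𝟙-yes (no ¬p) p = contradiction p ¬p

𝟙-no : ∀ {p} {P : Set p} (P? : Dec P) → ¬ P → 𝟙 P? ≡ + 0
𝟙-no (yes p) ¬p = contradiction p ¬p
𝟙-no (no _)  _  = refl

length-filter-applyUpTo : ∀ {P : ℕ → Set} (P? : Decidable P) (f : ℕ → ℕ) N →
  + length (filter P? (applyUpTo f N)) ≡ ∑[ i < N ] 𝟙 (P? (f i))
length-filter-applyUpTo P? f zero = refl
length-filter-applyUpTo P? f (suc N) with P? (f 0)
... | yes _ = cong (λ x → + 1 + x) (length-filter-applyUpTo P? (f ∘ suc) N)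
... | no _  = trans (length-filter-applyUpTo P? (f ∘ suc) N) (sym (+-identityˡ _))

∑-𝟙≟-* : ∀ {N x} (g : ℕ → ℤ) → x < N → ∑[ s < N ] (𝟙 (s ≟ x) * g s) ≡ g x
∑-𝟙≟-* {x = x} g x<N =
  trans (∑-single x x<N (λ {s} _ s≢x → cong (_* g s) (𝟙-no (s ≟ x) s≢x)))
        (trans (cong (_* g x) (𝟙-yes (x ≟ x) refl)) (*-identityˡ (g x)))

∑-𝟙≟-*-≥ : ∀ {N x} (g : ℕ → ℤ) → N ≤ x → ∑[ s < N ] (𝟙 (s ≟ x) * g s) ≡ + 0
∑-𝟙≟-*-≥ {N} {x} g N≤x =
  ∑-zero N (λ {s} s<N → cong (_* g s) (𝟙-no (s ≟ x) (λ { refl → ℕP.<⇒≱ s<N N≤x })))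

τ-as-∑ : ∀ {s N} → s < N → + τ (suc s) ≡ ∑[ t < N ] 𝟙 (suc t ∣? suc s)
τ-as-∑ {s} {N} s<N = begin
  + τ (suc s)
    ≡⟨ cong (λ ds → + length (filter (_∣? suc s) ds)) (map-upTo suc (suc s)) ⟩
  + length (filter (_∣? suc s) (applyUpTo suc (suc s)))
    ≡⟨ length-filter-applyUpTo (_∣? suc s) suc (suc s) ⟩
  ∑[ t < suc s ] 𝟙 (suc t ∣? suc s)
    ≡⟨ ∑-extend s<N (λ s<t _ → 𝟙-no (_ ∣? suc s) (ℕP.<⇒≱ (s<s s<t) ∘ ∣⇒≤)) ⟩
  ∑[ t < N ] 𝟙 (suc t ∣? suc s)
    ∎
  where open ≡-Reasoning

-- δ s t j = 1 iff s + 1 = (j + 1)(t + 1): the indices are d - 1, m - 1, q - 1 for d = q m.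
δ : ℕ → ℕ → ℕ → ℤ
δ s t j = 𝟙 (s ≟ t ℕ.+ j ℕ.* suc t)

∣-as-∑δ : ∀ {s N} t → s < N → 𝟙 (suc t ∣? suc s) ≡ ∑[ j < N ] δ s t j
∣-as-∑δ {s} {N} t s<N with suc t ∣? suc s
... | no t∤s = sym (∑-zero N (λ {j} _ → 𝟙-no (s ≟ _) (t∤s ∘ divides (suc j) ∘ cong suc)))
... | yes (divides (suc q) e) = sym (trans (∑-single q q<N others) (𝟙-yes (s ≟ _) s≡))
  where
  s≡ : s ≡ t ℕ.+ q ℕ.* suc t
  s≡ = suc-injective e
  q<N : q < N
  q<N = begin-strict
    q                  ≤⟨ ℕP.m≤m*n q (suc t) ⟩
    q ℕ.* suc t        ≤⟨ ℕP.m≤n+m _ t ⟩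
    t ℕ.+ q ℕ.* suc t  ≡⟨ sym s≡ ⟩
    s                  <⟨ s<N ⟩
    N                  ∎
    where open ℕP.≤-Reasoning
  others : ∀ {j} → j < N → j ≢ q → δ s t j ≡ + 0
  others {j} _ j≢q = 𝟙-no (s ≟ _) (λ s≡′ →
    j≢q (ℕP.*-cancelʳ-≡ j q (suc t) (ℕP.+-cancelˡ-≡ t _ _ (trans (sym s≡′) s≡))))

τ-as-∑∑δ : ∀ {s N} → s < N → + τ (suc s) ≡ ∑[ t < N ] ∑[ j < N ] δ s t j
τ-as-∑∑δ {N = N} s<N = trans (τ-as-∑ s<N) (∑-cong N (λ {t} _ → ∣-as-∑δ t s<N))

m-n*o≡m⊖n*o : ∀ a j m → + a - + j * + m ≡ a ⊖ j ℕ.* m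
m-n*o≡m⊖n*o a j m =
  trans (cong (λ x → + a - x) (sym (pos-* j m))) (m-n≡m⊖n a (j ℕ.* m))

module _ (φ : ℤ → ℤ) (φ-neg : ∀ m → φ -[1+ m ] ≡ + 0) where

  φ-sub-*-≤ : ∀ a j m → j ℕ.* m ≤ a → φ (+ a - + j * + m) ≡ φ (+ (a ∸ j ℕ.* m))
  φ-sub-*-≤ a j m jm≤a = cong φ (trans (m-n*o≡m⊖n*o a j m) (⊖-≥ jm≤a))

  φ-sub-*-> : ∀ a j m → a < j ℕ.* m → φ (+ a - + j * + m) ≡ + 0
  φ-sub-*-> a j m a<jm =
    trans (cong φ (trans (m-n*o≡m⊖n*o a j m) (⊖-< a<jm))) (φ-neg-pos (ℕP.m<n⇒0<n∸m a<jm))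
    where
    φ-neg-pos : ∀ {c} → 0 < c → φ (- + c) ≡ + 0
    φ-neg-pos {suc c} _ = φ-neg c

  module _ (n : ℕ) where

    weight : ℕ → ℤ
    weight s = φ (+ (n ∸ suc s))

    term : ℕ → ℕ → ℤ
    term t j = φ (+ (n ∸ suc t) - + j * + suc t)

    factorisationSum : ℤ
    factorisationSum = ∑[ s < n ] ∑[ t < n ] ∑[ j < n ] (δ s t j * weight s)

    left≡factorisationSum : ∑ℤ[ 1 ⋯ n ] (λ k → + τ k * φ (+ (n ∸ k))) ≡ factorisationSum
    left≡factorisationSum = begin
      ∑ℤ[ 1 ⋯ n ] (λ k → + τ k * φ (+ (n ∸ k)))
        ≡⟨ ∑ℤ-as-∑ 1 n (λ k → + τ k * φ (+ (n ∸ k))) ⟩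
      ∑[ s < n ] (+ τ (suc s) * weight s)
        ≡⟨ ∑-cong n (λ {s} s<n → cong (_* weight s) (τ-as-∑∑δ s<n)) ⟩
      ∑[ s < n ] ((∑[ t < n ] ∑[ j < n ] δ s t j) * weight s)
        ≡⟨ ∑-cong n (λ _ → trans (*-distribʳ-∑ n _ _) (∑-cong n (λ _ → *-distribʳ-∑ n _ _))) ⟩
      factorisationSum
        ∎
      where open ≡-Reasoning

    term-as-∑δ : ∀ {t} j → t < n → term t j ≡ ∑[ s < n ] (δ s t j * weight s)
    term-as-∑δ {t} j t<n with j ℕ.* suc t ≤? n ∸ suc t
    ... | yes fits = begin
      term t j                          ≡⟨ φ-sub-*-≤ (n ∸ suc t) j (suc t) fits ⟩
      φ (+ (n ∸ suc t ∸ j ℕ.* suc t))   ≡⟨ cong (φ ∘ +_) (ℕP.∸-+-assoc n (suc t) _) ⟩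
      weight d                          ≡⟨ sym (∑-𝟙≟-* weight d<n) ⟩
      ∑[ s < n ] (δ s t j * weight s)   ∎
      where
      open ≡-Reasoning
      d : ℕ
      d = t ℕ.+ j ℕ.* suc t
      d<n : d < n
      d<n = ≤-trans (≤-reflexive (ℕP.+-comm (suc t) _)) (ℕP.m≤o∸n⇒m+n≤o _ t<n fits)
    ... | no overflows =
      trans (φ-sub-*-> (n ∸ suc t) j (suc t) (ℕP.≰⇒> overflows))
            (sym (∑-𝟙≟-*-≥ weight n≤d))
      where
      n≤d : n ≤ t ℕ.+ j ℕ.* suc t
      n≤d = ℕP.≮⇒≥ (λ d<n →
        overflows (ℕP.m+n≤o⇒m≤o∸n _ (≤-trans (≤-reflexive (ℕP.+-comm _ (suc t))) d<n)))

    inner-∑-as-∑∑δ : ∀ {t} → t < n →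
      ∑[ j < suc (n ∸ suc t) ] term t j ≡ ∑[ s < n ] ∑[ j < n ] (δ s t j * weight s)
    inner-∑-as-∑∑δ {t} t<n = begin
      ∑[ j < suc (n ∸ suc t) ] term t j
        ≡⟨ ∑-extend (ℕP.∸-monoʳ-< z<s t<n) (λ {j} past-end _ →
             φ-sub-*-> (n ∸ suc t) j (suc t) (ℕP.<-≤-trans past-end (ℕP.m≤m*n j (suc t)))) ⟩
      ∑[ j < n ] term t j
        ≡⟨ ∑-cong n (λ {j} _ → term-as-∑δ j t<n) ⟩
      ∑[ j < n ] ∑[ s < n ] (δ s t j * weight s)
        ≡⟨ ∑-comm n n _ ⟩
      ∑[ s < n ] ∑[ j < n ] (δ s t j * weight s)
        ∎
      where open ≡-Reasoning

    right≡factorisationSum :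
      ∑ℤ[ 1 ⋯ n ] (λ m → ∑ℤ[ 0 ⋯ n ∸ m ] (λ j → φ (+ (n ∸ m) - + j * + m)))
        ≡ factorisationSum
    right≡factorisationSum = begin
      ∑ℤ[ 1 ⋯ n ] (λ m → ∑ℤ[ 0 ⋯ n ∸ m ] (λ j → φ (+ (n ∸ m) - + j * + m)))
        ≡⟨ ∑ℤ-as-∑ 1 n (λ m → ∑ℤ[ 0 ⋯ n ∸ m ] (λ j → φ (+ (n ∸ m) - + j * + m))) ⟩
      ∑[ t < n ] ∑ℤ[ 0 ⋯ n ∸ suc t ] (term t)
        ≡⟨ ∑-cong n (λ {t} t<n →
             trans (∑ℤ-as-∑ 0 (n ∸ suc t) (term t)) (inner-∑-as-∑∑δ t<n)) ⟩
      ∑[ t < n ] ∑[ s < n ] ∑[ j < n ] (δ s t j * weight s)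
        ≡⟨ ∑-comm n n _ ⟩
      factorisationSum
        ∎
      where open ≡-Reasoning

mainTheorem9 : (n : ℕ) → n ≥ 1 →
    ∑ℤ[ 1 ⋯ n ] (λ k → + τ k * ω (+ (n ∸ k)))
      ≡ ∑ℤ[ 1 ⋯ n ] (λ m → ∑ℤ[ 0 ⋯ n ∸ m ] (λ j → ω (+ (n ∸ m) - + j * + m)))
mainTheorem9 n _ =
  trans (left≡factorisationSum ω ω-neg n) (sym (right≡factorisationSum ω ω-neg n))
  where
  ω-neg : ∀ m → ω -[1+ m ] ≡ + 0
  ω-neg _ = refl
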